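{- In the category of preorders, admissible maps are stable under pullback along identity-on-objects monotone maps: if $\beta\colon V'\to V$ is an admissible map and $f\colon T\to V$ is an identity-on-objects monotone map of preorders, then the projection $V'\times_VT\to T$ is an admissible map.
   Context: For an identity-on-objects monotone map $T'\to T$ of preorders, $T/T'$ is the preorder on the same objects obtained as the transitive closure of the relation $x\,\mathcal R\,y\iff(x\le_Ty\ \text{or}\ y\le_{T'}x)$ (i.e. one inverts the relations of $T$ that belong to $T'$). Write $x\sim_Ty$ if $x\le_Ty$ and $y\le_Tx$. A map of preorders $T'\to T$ is admissible if (1) it is the identity on objects; (2) for every connected sub-preorder $Y$ of $T'$, the restriction of $T$ to the underlying set of $Y$ equals $Y$ (i.e. $T$ induces exactly the relations of $Y$ on its elements); (3) for all $x,y$: $x\sim_{T/T'}y$ if and only if $x\sim_{T'/T'}y$. Pullbacks are computed in the category of preorders. -}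

module Defs where

open import Level using (Level; _⊔_)
open import Data.Product using (Σ; ∃; _×_; _,_)
open import Data.Sum using (_⊎_)
open import Relation.Unary using (Pred)
open import Relation.Binary using (Rel; IsPreorder)
open import Relation.Binary.PropositionalEquality using (_≡_)
open import Relation.Binary.Construct.Closure.Transitive using (TransClosure)
open import Relation.Binary.Construct.Closure.ReflexiveTransitive using (Star)

-- A preorder on a fixed set of objects A (identity-on-objects maps between
-- preorders are then maps between preorders on the same object set A).
record PreorderOn {a : Level} (A : Set a) (ℓ : Level) : Set (a ⊔ Level.suc ℓ) where
  field
    _≤_        : Rel A ℓ
    isPreorder : IsPreorder _≡_ _≤_
open PreorderOn public

module _ {a ℓ : Level} {A : Set a} where

  IdMonotone : PreorderOn A ℓ → PreorderOn A ℓ → Set (a ⊔ ℓ)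
  IdMonotone T' T = ∀ {x y} → _≤_ T' x y → _≤_ T x y

  Quot : PreorderOn A ℓ → PreorderOn A ℓ → Rel A (a ⊔ ℓ)
  Quot T T' = TransClosure (λ x y → _≤_ T x y ⊎ _≤_ T' y x)

  QuotIso : PreorderOn A ℓ → PreorderOn A ℓ → Rel A (a ⊔ ℓ)
  QuotIso T T' x y = Quot T T' x y × Quot T T' y x

  ZigEdge : PreorderOn A ℓ → Pred A (a ⊔ ℓ) → Rel A (a ⊔ ℓ)
  ZigEdge T' S x y = S x × S y × (_≤_ T' x y ⊎ _≤_ T' y x)

  Connected : PreorderOn A ℓ → Pred A (a ⊔ ℓ) → Set (a ⊔ ℓ)
  Connected T' S = (∃ λ x → S x) × (∀ x y → S x → S y → Star (ZigEdge T' S) x y)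

  record Admissible (T' T : PreorderOn A ℓ) : Set (Level.suc (a ⊔ ℓ)) where
    field
      monotone : IdMonotone T' T
      restrict : ∀ (S : Pred A (a ⊔ ℓ)) → Connected T' S →
                 ∀ x y → S x → S y → (_≤_ T x y → _≤_ T' x y) × (_≤_ T' x y → _≤_ T x y)
      isos     : ∀ x y → (QuotIso T T' x y → QuotIso T' T' x y) × (QuotIso T' T' x y → QuotIso T T' x y)

  -- Pullback V' ×_V T of identity-on-objects maps V' → V ← T, computed in
  -- preorders: objects are pairs (v', t) with v' = t, i.e. (canonically) A
  -- itself, with (x ≤ y) iff x ≤_{V'} y and x ≤_T y.
  Pullback : PreorderOn A ℓ → PreorderOn A ℓ → PreorderOn A ℓ
  Pullback V' T = record
    { _≤_ = λ x y → _≤_ V' x y × _≤_ T x y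
    ; isPreorder = record
      { isEquivalence = IsPreorder.isEquivalence (isPreorder V')
      ; reflexive = λ e → IsPreorder.reflexive (isPreorder V') e , IsPreorder.reflexive (isPreorder T) e
      ; trans = λ { (p , q) (p' , q') → IsPreorder.trans (isPreorder V') p p' , IsPreorder.trans (isPreorder T) q q' }
      }
    }

{-# OPTIONS --safe #-}
module Submission where

open import Level using (Level; _⊔_)
open import Data.Product using (_,_; proj₁; proj₂)
open import Data.Sum using (_⊎_; inj₁; inj₂)
open import Function using (id)
open import Relation.Unary using (Pred)
open import Relation.Binary using (Rel; _⇒_)
open import Relation.Binary.Construct.Closure.Transitive using (TransClosure; [_]; _∷_; _∷ʳ_; _++_)
open import Relation.Binary.Construct.Closure.ReflexiveTransitive as Star using (Star; ε; _◅_; _◅◅_)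
open import Defs

-- The projection V' ×_V T → T is monotone, and a zigzag in the
-- pullback is a zigzag in V', so condition (2) for β upgrades T-relations inside
-- a connected set to V'-relations. For (3), a cycle of T/(V' ×_V T) maps to a
-- cycle of V/V', so by (3) for β all its points lie in one V'-component; there
-- each T-step is, by (2) for β, also a V'-step, i.e. a step of the pullback.

module _ {a r : Level} {A : Set a} {R : Rel A r} where

  ⁺⇒* : TransClosure R ⇒ Star R
  ⁺⇒* [ p ]    = p ◅ ε
  ⁺⇒* (p ∷ ps) = p ◅ ⁺⇒* ps

  map⁺ : ∀ {s} {S : Rel A s} → R ⇒ S → TransClosure R ⇒ TransClosure S
  map⁺ R⇒S [ p ]    = [ R⇒S p ]
  map⁺ R⇒S (p ∷ ps) = R⇒S p ∷ map⁺ R⇒S ps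

  cycle-map⁺ : ∀ {s} {S : Rel A s} → (∀ {u v} → R u v → TransClosure R v u → S u v) →
               ∀ {u v} → TransClosure R u v → TransClosure R v u → TransClosure S u v
  cycle-map⁺ on-cycle [ p ]    vu = [ on-cycle p vu ]
  cycle-map⁺ on-cycle (p ∷ ps) vu = on-cycle p (ps ++ vu) ∷ cycle-map⁺ on-cycle ps (vu ∷ʳ p)

module _ {a ℓ : Level} {A : Set a} where

  Zigzag : PreorderOn A ℓ → Rel A (a ⊔ ℓ)
  Zigzag T = Star (λ x y → _≤_ T x y ⊎ _≤_ T y x)

  zigzag-connected : (T : PreorderOn A ℓ) (x : A) → Connected T (Zigzag T x)
  zigzag-connected T x = (x , ε) , λ u v xu xv → Star.reverse flip (from xu) ◅◅ from xv
    where
    flip : ∀ {u v} → ZigEdge T (Zigzag T x) u v → ZigEdge T (Zigzag T x) v u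
    flip (xu , xv , inj₁ p) = xv , xu , inj₂ p
    flip (xu , xv , inj₂ p) = xv , xu , inj₁ p

    along : ∀ {u v} → Zigzag T x u → Zigzag T u v → Star (ZigEdge T (Zigzag T x)) u v
    along xu ε        = ε
    along xu (e ◅ es) = (xu , xw , e) ◅ along xw es
      where xw = xu ◅◅ (e ◅ ε)

    from : ∀ {v} → Zigzag T x v → Star (ZigEdge T (Zigzag T x)) x v
    from = along ε

  connected-mono : {T₁ T₂ : PreorderOn A ℓ} → IdMonotone T₁ T₂ →
                   {S : Pred A (a ⊔ ℓ)} → Connected T₁ S → Connected T₂ S
  connected-mono {T₁} {T₂} T₁⇒T₂ {S} (s , zig) = s , λ u v su sv → Star.map edge (zig u v su sv)
    where
    edge : ∀ {u v} → ZigEdge T₁ S u v → ZigEdge T₂ S u v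
    edge (su , sv , inj₁ p) = su , sv , inj₁ (T₁⇒T₂ p)
    edge (su , sv , inj₂ p) = su , sv , inj₂ (T₁⇒T₂ p)

  Quot-mono : {T₁ T₂ T₁' T₂' : PreorderOn A ℓ} → IdMonotone T₁ T₂ → IdMonotone T₁' T₂' →
              Quot T₁ T₁' ⇒ Quot T₂ T₂'
  Quot-mono T₁⇒T₂ T₁'⇒T₂' = map⁺ λ { (inj₁ p) → inj₁ (T₁⇒T₂ p) ; (inj₂ p) → inj₂ (T₁'⇒T₂' p) }

  QuotIso-mono : {T₁ T₂ T₁' T₂' : PreorderOn A ℓ} → IdMonotone T₁ T₂ → IdMonotone T₁' T₂' →
                 QuotIso T₁ T₁' ⇒ QuotIso T₂ T₂'
  QuotIso-mono {T₁} {T₂} {T₁'} {T₂'} T₁⇒T₂ T₁'⇒T₂' (xy , yx) = mono xy , mono yx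
    where
    mono : Quot T₁ T₁' ⇒ Quot T₂ T₂'
    mono = Quot-mono {T₁} {T₂} {T₁'} {T₂'} T₁⇒T₂ T₁'⇒T₂'

  module _ {V' V : PreorderOn A ℓ} (β : Admissible V' V) where
    open Admissible β

    reflect-connected : {S : Pred A (a ⊔ ℓ)} → Connected V' S →
                        ∀ {u v} → S u → S v → _≤_ V u v → _≤_ V' u v
    reflect-connected {S} conn su sv = proj₁ (restrict S conn _ _ su sv)

    reflect-iso : ∀ {u v} → QuotIso V V' u v → _≤_ V u v → _≤_ V' u v
    reflect-iso {u} uv = reflect-connected (zigzag-connected V' u) ε (⁺⇒* (proj₁ (proj₁ (isos _ _) uv)))

  module _ (V' V T : PreorderOn A ℓ) (β : Admissible V' V) (f : IdMonotone T V) where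
    private
      P = Pullback V' T

      V'-projection : IdMonotone P V'
      V'-projection = proj₁

    pullback-reflect-connected : {S : Pred A (a ⊔ ℓ)} → Connected P S →
                                 ∀ {u v} → S u → S v → _≤_ T u v → _≤_ P u v
    pullback-reflect-connected conn su sv p =
      reflect-connected β (connected-mono {P} {V'} V'-projection conn) su sv (f p) , p

    pullback-step-on-cycle : ∀ {u v} → (_≤_ T u v ⊎ _≤_ P v u) → Quot T P v u →
                             _≤_ P u v ⊎ _≤_ P v u
    pullback-step-on-cycle (inj₂ p) _  = inj₂ p
    pullback-step-on-cycle (inj₁ p) vu =
      inj₁ (reflect-iso β (QuotIso-mono {T} {V} {P} {V'} f V'-projection ([ inj₁ p ] , vu)) (f p) , p)

    pullback-iso : ∀ {x y} → QuotIso T P x y → QuotIso P P x y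
    pullback-iso (xy , yx) = cycle-map⁺ pullback-step-on-cycle xy yx
                           , cycle-map⁺ pullback-step-on-cycle yx xy

lemma4p4 : {a ℓ : Level} {A : Set a} (V' V T : PreorderOn A ℓ) →
    (β : Admissible V' V) → (f : IdMonotone T V) →
    Admissible (Pullback V' T) T
lemma4p4 V' V T β f = record
  { monotone = proj₂
  ; restrict = λ S conn x y sx sy → pullback-reflect-connected V' V T β f conn sx sy , proj₂
  ; isos     = λ x y → pullback-iso V' V T β f , QuotIso-mono {T₁ = P} {T} {P} {P} proj₂ id
  }
  where P = Pullback V' T
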